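{- If $G$ is a graph with $n \ge 1$ vertices, $m$ edges and $t$ triangles, then $G$ can be made bipartite by deleting at most $m-\frac{4m^2}{n^2}+\frac{6t}{n}$ edges. -}

module Defs where

open import Data.Nat using (ℕ; _+_; _<ᵇ_)
open import Data.Bool using (Bool; true; false; _∧_; if_then_else_)
open import Data.Fin using (Fin; toℕ)
open import Data.List using (List; map; allFin)
open import Data.Nat.ListAction using (sum)
open import Relation.Binary.PropositionalEquality using (_≡_)
open import Data.Empty using (⊥)

record Graph (n : ℕ) : Set where
  field
    adj     : Fin n → Fin n → Bool
    adj-sym : ∀ i j → adj i j ≡ adj j i
    irrefl  : ∀ i → adj i i ≡ false
open Graph public

[_] : Bool → ℕ
[ b ] = if b then 1 else 0

Σv : ∀ {n} → (Fin n → ℕ) → ℕ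
Σv {n} f = sum (map f (allFin n))

pairCount : ∀ {n} → (Fin n → Fin n → Bool) → ℕ
pairCount R = Σv λ i → Σv λ j → [ (toℕ i <ᵇ toℕ j) ∧ R i j ]

edges : ∀ {n} → Graph n → ℕ
edges G = pairCount (adj G)

triangles : ∀ {n} → Graph n → ℕ
triangles G = Σv λ i → Σv λ j → Σv λ k →
  [ (toℕ i <ᵇ toℕ j) ∧ (toℕ j <ᵇ toℕ k) ∧ adj G i j ∧ adj G j k ∧ adj G i k ]

record BipartiteAfterDeleting {n : ℕ} (G : Graph n) (D : Fin n → Fin n → Bool) : Set where
  field
    D-sym    : ∀ i j → D i j ≡ D j i
    D⊆E      : ∀ i j → D i j ≡ true → adj G i j ≡ true
    colour   : Fin n → Bool
    proper   : ∀ i j → adj G i j ≡ true → D i j ≡ false → colour i ≡ colour j → ⊥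

module Submission where

-- For a vertex v, colour every vertex by whether it is adjacent to v
-- and delete the edges whose ends receive the same colour; the rest is
-- bipartite.  Let del v be the number of deleted edges and d i the degree of
-- i.  An ordered pair (i,j) of adjacent vertices is deleted for v exactly when
-- v is adjacent to both of them or to neither, so double counting over all
-- triples (v,i,j) gives the identity
--     Σ_v del v + Σ_i (d i)² = n·m + 6·t.                               (*)
-- Choosing v with del v at most the average, and bounding Σ_i (d i)² from
-- below by (2m)²/n (Cauchy–Schwarz with the handshake lemma Σ_i d i = 2m),
-- turns (*) into the claimed bound.

open import Defs
open import Data.Nat using (ℕ; zero; suc; _+_; _*_; _≤_; _^_; _<ᵇ_; z≤n)
open import Data.Nat.Properties hiding (_≟_)
open import Data.Nat.ListAction using (sum)
open import Data.Nat.Tactic.RingSolver using (solve-∀)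
open import Data.Fin as Fin using (Fin; toℕ)
open import Data.Fin.Properties using (toℕ-injective; _≟_)
open import Data.Bool using (Bool; true; false; _∧_; not; _xor_)
open import Data.Bool.Properties using (xor-comm; xor-same)
open import Data.List using (List; []; _∷_; map; allFin; length)
open import Data.List.Properties using (length-tabulate)
open import Data.List.Extrema.Nat using (argmin; f[argmin]≤f[xs])
open import Data.List.Membership.Propositional.Properties using (∈-allFin)
import Data.List.Relation.Unary.All as All
open import Data.Product using (Σ; _×_; _,_)
open import Data.Empty using (⊥)
open import Relation.Nullary using (yes; no; contradiction)
open import Relation.Binary.PropositionalEquality hiding ([_])
open import Algebra.Properties.CommutativeSemigroup +-commutativeSemigroup
  using (interchange)

module _ {A : Set} where

  sum-map-cong : ∀ (xs : List A) {f g : A → ℕ} → (∀ x → f x ≡ g x) →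
    sum (map f xs) ≡ sum (map g xs)
  sum-map-cong []       f≗g = refl
  sum-map-cong (x ∷ xs) f≗g = cong₂ _+_ (f≗g x) (sum-map-cong xs f≗g)

  sum-map-mono : ∀ (xs : List A) {f g : A → ℕ} → (∀ x → f x ≤ g x) →
    sum (map f xs) ≤ sum (map g xs)
  sum-map-mono []       f≤g = z≤n
  sum-map-mono (x ∷ xs) f≤g = +-mono-≤ (f≤g x) (sum-map-mono xs f≤g)

  sum-map-+ : ∀ (xs : List A) (f g : A → ℕ) →
    sum (map (λ x → f x + g x) xs) ≡ sum (map f xs) + sum (map g xs)
  sum-map-+ []       f g = refl
  sum-map-+ (x ∷ xs) f g =
    trans (cong (f x + g x +_) (sum-map-+ xs f g)) (interchange (f x) (g x) _ _)

  sum-map-*ˡ : ∀ (xs : List A) (c : ℕ) (f : A → ℕ) →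
    sum (map (λ x → c * f x) xs) ≡ c * sum (map f xs)
  sum-map-*ˡ []       c f = sym (*-zeroʳ c)
  sum-map-*ˡ (x ∷ xs) c f =
    trans (cong (c * f x +_) (sum-map-*ˡ xs c f)) (sym (*-distribˡ-+ c (f x) _))

  sum-map-const : ∀ (xs : List A) (c : ℕ) → sum (map (λ _ → c) xs) ≡ length xs * c
  sum-map-const []       c = refl
  sum-map-const (x ∷ xs) c = cong (c +_) (sum-map-const xs c)

sum-map-swap : ∀ {A B : Set} (xs : List A) (ys : List B) (f : A → B → ℕ) →
  sum (map (λ x → sum (map (f x) ys)) xs) ≡ sum (map (λ y → sum (map (λ x → f x y) xs)) ys)
sum-map-swap []       ys f =
  sym (trans (sum-map-const ys 0) (*-zeroʳ (length ys)))
sum-map-swap (x ∷ xs) ys f =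
  trans (cong (sum (map (f x) ys) +_) (sum-map-swap xs ys f))
        (sym (sum-map-+ ys (f x) (λ y → sum (map (λ x → f x y) xs))))

module _ {n : ℕ} where

  Σv-cong : {f g : Fin n → ℕ} → (∀ i → f i ≡ g i) → Σv f ≡ Σv g
  Σv-cong = sum-map-cong (allFin n)

  Σv-mono : {f g : Fin n → ℕ} → (∀ i → f i ≤ g i) → Σv f ≤ Σv g
  Σv-mono = sum-map-mono (allFin n)

  Σv-+ : (f g : Fin n → ℕ) → Σv (λ i → f i + g i) ≡ Σv f + Σv g
  Σv-+ = sum-map-+ (allFin n)

  Σv-*ˡ : (c : ℕ) (f : Fin n → ℕ) → Σv (λ i → c * f i) ≡ c * Σv f
  Σv-*ˡ = sum-map-*ˡ (allFin n)

  Σv-*ʳ : (c : ℕ) (f : Fin n → ℕ) → Σv (λ i → f i * c) ≡ Σv f * c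
  Σv-*ʳ c f = trans (Σv-cong (λ i → *-comm (f i) c))
                    (trans (Σv-*ˡ c f) (*-comm c (Σv f)))

  Σv-const : (c : ℕ) → Σv {n} (λ _ → c) ≡ n * c
  Σv-const c = trans (sum-map-const (allFin n) c)
                     (cong (_* c) (length-tabulate {n = n} (λ i → i)))

  Σv-swap : (f : Fin n → Fin n → ℕ) →
    Σv (λ i → Σv (λ j → f i j)) ≡ Σv (λ j → Σv (λ i → f i j))
  Σv-swap = sum-map-swap (allFin n) (allFin n)

  Σ³ : (Fin n → Fin n → Fin n → ℕ) → ℕ
  Σ³ f = Σv λ i → Σv λ j → Σv λ k → f i j k

  Σ³-cong : {f g : Fin n → Fin n → Fin n → ℕ} → (∀ i j k → f i j k ≡ g i j k) →
    Σ³ f ≡ Σ³ g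
  Σ³-cong f≗g = Σv-cong (λ i → Σv-cong (λ j → Σv-cong (f≗g i j)))

  Σ³-+ : (f g : Fin n → Fin n → Fin n → ℕ) →
    Σ³ (λ i j k → f i j k + g i j k) ≡ Σ³ f + Σ³ g
  Σ³-+ f g = trans (Σv-cong (λ i → trans (Σv-cong (λ j → Σv-+ (f i j) (g i j)))
                                         (Σv-+ _ _)))
                   (Σv-+ _ _)

  Σ³-*ˡ : (c : ℕ) (f : Fin n → Fin n → Fin n → ℕ) →
    Σ³ (λ i j k → c * f i j k) ≡ c * Σ³ f
  Σ³-*ˡ c f = trans (Σv-cong (λ i → trans (Σv-cong (λ j → Σv-*ˡ c (f i j)))
                                          (Σv-*ˡ c _)))
                    (Σv-*ˡ c _)

  Σ³-swap₁₂ : (f : Fin n → Fin n → Fin n → ℕ) → Σ³ (λ i j k → f j i k) ≡ Σ³ f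
  Σ³-swap₁₂ f = Σv-swap (λ j i → Σv (λ k → f i j k))

  Σ³-swap₂₃ : (f : Fin n → Fin n → Fin n → ℕ) → Σ³ (λ i j k → f i k j) ≡ Σ³ f
  Σ³-swap₂₃ f = Σv-cong (λ i → Σv-swap (λ k j → f i j k))

[∧] : ∀ a b → [ a ∧ b ] ≡ [ a ] * [ b ]
[∧] true  b = sym (+-identityʳ [ b ])
[∧] false b = refl

<ᵇ-flip : ∀ x y → x ≢ y → (y <ᵇ x) ≡ not (x <ᵇ y)
<ᵇ-flip zero    zero    x≢y = contradiction refl x≢y
<ᵇ-flip zero    (suc y) x≢y = refl
<ᵇ-flip (suc x) zero    x≢y = refl
<ᵇ-flip (suc x) (suc y) x≢y = <ᵇ-flip x y (λ x≡y → x≢y (cong suc x≡y))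

<ᵇ-trans : ∀ x y z → (x <ᵇ y) ≡ true → (y <ᵇ z) ≡ true → (x <ᵇ z) ≡ true
<ᵇ-trans zero    (suc y) (suc z) _   _   = refl
<ᵇ-trans (suc x) (suc y) (suc z) x<y y<z = <ᵇ-trans x y z x<y y<z
<ᵇ-trans zero    zero    _       ()  _
<ᵇ-trans (suc x) zero    _       ()  _
<ᵇ-trans _       (suc y) zero    _   ()

exactly-one-of-two : ∀ x y → x ≢ y → [ x <ᵇ y ] + [ y <ᵇ x ] ≡ 1
exactly-one-of-two x y x≢y rewrite <ᵇ-flip x y x≢y with x <ᵇ y
... | true  = refl
... | false = refl

increasing : ℕ → ℕ → ℕ → ℕ
increasing x y z = [ x <ᵇ y ] * [ y <ᵇ z ]

orderings : ℕ → ℕ → ℕ → ℕ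
orderings x y z = increasing x y z + increasing x z y + increasing y x z
                + increasing y z x + increasing z x y + increasing z y x

-- Writing p, q, r for x < y, y < z, x < z, the six orderings of distinct
-- x, y, z are the six consistent sign patterns; transitivity in both
-- directions rules out the two cyclic ones.
one-consistent-pattern : ∀ p q r →
  (p ≡ true → q ≡ true → r ≡ true) → (p ≡ false → q ≡ false → r ≡ false) →
  [ p ] * [ q ] + [ r ] * [ not q ] + [ not p ] * [ r ]
    + [ q ] * [ not r ] + [ not r ] * [ p ] + [ not q ] * [ not p ] ≡ 1
one-consistent-pattern true  true  true  _       _       = refl
one-consistent-pattern true  true  false forward _       with forward refl refl
... | ()
one-consistent-pattern true  false true  _       _       = refl
one-consistent-pattern true  false false _       _       = refl
one-consistent-pattern false true  true  _       _       = refl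
one-consistent-pattern false true  false _       _       = refl
one-consistent-pattern false false true  _       reverse with reverse refl refl
... | ()
one-consistent-pattern false false false _       _       = refl

exactly-one-ordering : ∀ x y z → x ≢ y → y ≢ z → x ≢ z → orderings x y z ≡ 1
exactly-one-ordering x y z x≢y y≢z x≢z
  rewrite <ᵇ-flip x y x≢y | <ᵇ-flip y z y≢z | <ᵇ-flip x z x≢z =
  one-consistent-pattern (x <ᵇ y) (y <ᵇ z) (x <ᵇ z) (<ᵇ-trans x y z) descending
  where
  not-true : ∀ {b} → not b ≡ true → b ≡ false
  not-true {false} _ = refl

  descending : (x <ᵇ y) ≡ false → (y <ᵇ z) ≡ false → (x <ᵇ z) ≡ false
  descending x≮y y≮z = not-true (trans (sym (<ᵇ-flip x z x≢z))
    (<ᵇ-trans z y x (trans (<ᵇ-flip y z y≢z) (cong not y≮z))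
                    (trans (<ᵇ-flip x y x≢y) (cong not x≮y))))

module _ {n : ℕ} where

  lt : Fin n → Fin n → ℕ
  lt i j = [ toℕ i <ᵇ toℕ j ]

  toℕ-distinct : {i j : Fin n} → i ≢ j → toℕ i ≢ toℕ j
  toℕ-distinct i≢j eq = i≢j (toℕ-injective eq)

  ordered-pairs : (f : Fin n → Fin n → ℕ) →
    (∀ i j → f i j ≡ f j i) → (∀ i → f i i ≡ 0) →
    Σv (λ i → Σv (λ j → f i j)) ≡ 2 * Σv (λ i → Σv (λ j → lt i j * f i j))
  ordered-pairs f f-sym f-diag = begin
    Σv (λ i → Σv (λ j → f i j))                       ≡⟨ Σv-cong (λ i → Σv-cong (split i)) ⟩
    Σv (λ i → Σv (λ j → g i j + g j i))               ≡⟨ Σv-cong (λ i → Σv-+ (g i) (λ j → g j i)) ⟩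
    Σv (λ i → Σv (g i) + Σv (λ j → g j i))            ≡⟨ Σv-+ (λ i → Σv (g i)) _ ⟩
    P + Σv (λ i → Σv (λ j → g j i))                   ≡⟨ cong (P +_) (Σv-swap (λ i j → g j i)) ⟩
    P + P                                             ≡⟨ cong (P +_) (sym (+-identityʳ P)) ⟩
    2 * P                                             ∎
    where
    open ≡-Reasoning
    g : Fin n → Fin n → ℕ
    g i j = lt i j * f i j
    P : ℕ
    P = Σv (λ i → Σv (g i))

    split : ∀ i j → f i j ≡ g i j + g j i
    split i j with i ≟ j
    ... | yes refl rewrite f-diag i | *-zeroʳ (lt i i) = refl
    ... | no i≢j = begin
      f i j                               ≡⟨ sym (*-identityˡ (f i j)) ⟩
      1 * f i j                           ≡⟨ cong (_* f i j) (sym (exactly-one-of-two (toℕ i) (toℕ j) (toℕ-distinct i≢j))) ⟩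
      (lt i j + lt j i) * f i j           ≡⟨ *-distribʳ-+ (f i j) (lt i j) (lt j i) ⟩
      lt i j * f i j + lt j i * f i j     ≡⟨ cong (λ x → g i j + lt j i * x) (f-sym i j) ⟩
      g i j + g j i                       ∎

  inc-part : (Fin n → Fin n → Fin n → ℕ) → Fin n → Fin n → Fin n → ℕ
  inc-part f i j k = increasing (toℕ i) (toℕ j) (toℕ k) * f i j k

  Σ³-symmetrise : (B : Fin n → Fin n → Fin n → ℕ) →
    Σ³ (λ i j k → B i j k + B i k j + B j i k + B j k i + B k i j + B k j i) ≡ 6 * Σ³ B
  Σ³-symmetrise B =
    add 5 (λ i j k → B k j i) (add 4 (λ i j k → B k i j) (add 3 (λ i j k → B j k i)
      (add 2 (λ i j k → B j i k) (add 1 (λ i j k → B i k j) (sym (*-identityˡ (Σ³ B)))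
        (Σ³-swap₂₃ B))
        (Σ³-swap₁₂ B))
        (trans (Σ³-swap₁₂ (λ a b c → B a c b)) (Σ³-swap₂₃ B)))
        (trans (Σ³-swap₂₃ (λ a b c → B b a c)) (Σ³-swap₁₂ B)))
        (trans (Σ³-swap₁₂ (λ a b c → B c a b))
          (trans (Σ³-swap₂₃ (λ a b c → B b a c)) (Σ³-swap₁₂ B)))
    where
    add : ∀ c {h : Fin n → Fin n → Fin n → ℕ} (g : Fin n → Fin n → Fin n → ℕ) →
      Σ³ h ≡ c * Σ³ B → Σ³ g ≡ Σ³ B → Σ³ (λ i j k → h i j k + g i j k) ≡ suc c * Σ³ B
    add c {h} g h≡ g≡ =
      trans (Σ³-+ h g) (trans (cong₂ _+_ h≡ g≡) (+-comm (c * Σ³ B) (Σ³ B)))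

  ordered-triples : (f : Fin n → Fin n → Fin n → ℕ) →
    (∀ i j k → f i j k ≡ f j i k) → (∀ i j k → f i j k ≡ f i k j) →
    (∀ i k → f i i k ≡ 0) →
    Σ³ f ≡ 6 * Σ³ (inc-part f)
  ordered-triples f swap₁₂ swap₂₃ diag =
    trans (Σ³-cong six-orderings) (Σ³-symmetrise B)
    where
    B : Fin n → Fin n → Fin n → ℕ
    B = inc-part f

    inc : Fin n → Fin n → Fin n → ℕ
    inc i j k = increasing (toℕ i) (toℕ j) (toℕ k)

    o : Fin n → Fin n → Fin n → ℕ
    o i j k = orderings (toℕ i) (toℕ j) (toℕ k)

    -- f vanishes unless its arguments are distinct, and distinct arguments
    -- have exactly one increasing ordering
    weighted : ∀ i j k → f i j k ≡ o i j k * f i j k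
    weighted i j k with i ≟ j | j ≟ k | i ≟ k
    ... | yes refl | _        | _        rewrite diag i k = sym (*-zeroʳ (o i i k))
    ... | no _     | yes refl | _        rewrite swap₁₂ i j j | swap₂₃ j i j | diag j i =
      sym (*-zeroʳ (o i j j))
    ... | no _     | no _     | yes refl rewrite swap₂₃ i j i | diag i j =
      sym (*-zeroʳ (o i j i))
    ... | no i≢j   | no j≢k   | no i≢k   = sym (trans
      (cong (_* f i j k) (exactly-one-ordering (toℕ i) (toℕ j) (toℕ k)
        (toℕ-distinct i≢j) (toℕ-distinct j≢k) (toℕ-distinct i≢k)))
      (*-identityˡ (f i j k)))

    distrib₆ : ∀ a b c d e g x →
      a * x + b * x + c * x + d * x + e * x + g * x ≡ (a + b + c + d + e + g) * x
    distrib₆ = solve-∀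

    ikj : ∀ i j k → f i k j ≡ f i j k
    ikj i j k = sym (swap₂₃ i j k)
    jik : ∀ i j k → f j i k ≡ f i j k
    jik i j k = sym (swap₁₂ i j k)
    jki : ∀ i j k → f j k i ≡ f i j k
    jki i j k = trans (swap₂₃ j k i) (jik i j k)
    kij : ∀ i j k → f k i j ≡ f i j k
    kij i j k = trans (swap₁₂ k i j) (ikj i j k)
    kji : ∀ i j k → f k j i ≡ f i j k
    kji i j k = trans (swap₁₂ k j i) (jki i j k)

    six-orderings : ∀ i j k →
      f i j k ≡ B i j k + B i k j + B j i k + B j k i + B k i j + B k j i
    six-orderings i j k
      rewrite ikj i j k | jik i j k | jki i j k | kij i j k | kji i j k =
      trans (weighted i j k) (sym (distrib₆ (inc i j k) (inc i k j) (inc j i k)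
                                            (inc j k i) (inc k i j) (inc k j i) (f i j k)))

2xy≤x²+y² : ∀ x y → 2 * (x * y) ≤ x * x + y * y
2xy≤x²+y² zero    y       = z≤n
2xy≤x²+y² (suc x) zero    rewrite *-zeroʳ x = z≤n
2xy≤x²+y² (suc x) (suc y) =
  subst₂ _≤_ (lhs x y) (rhs x y) (+-monoʳ-≤ (2 + 2 * x + 2 * y) (2xy≤x²+y² x y))
  where
  lhs : ∀ x y → 2 + 2 * x + 2 * y + 2 * (x * y) ≡ 2 * (suc x * suc y)
  lhs = solve-∀
  rhs : ∀ x y → 2 + 2 * x + 2 * y + (x * x + y * y) ≡ suc x * suc x + suc y * suc y
  rhs = solve-∀

cauchy-schwarz : ∀ {n} (f : Fin n → ℕ) → Σv f * Σv f ≤ n * Σv (λ i → f i * f i)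
cauchy-schwarz {n} f = *-cancelˡ-≤ 2 (begin
  2 * (Σv f * Σv f)                              ≡⟨ sym products ⟩
  Σv (λ i → Σv (λ j → 2 * (f i * f j)))          ≤⟨ Σv-mono (λ i → Σv-mono (λ j → 2xy≤x²+y² (f i) (f j))) ⟩
  Σv (λ i → Σv (λ j → f i * f i + f j * f j))    ≡⟨ squares ⟩
  2 * (n * Q)                                    ∎)
  where
  open ≤-Reasoning
  Q : ℕ
  Q = Σv (λ i → f i * f i)

  products : Σv (λ i → Σv (λ j → 2 * (f i * f j))) ≡ 2 * (Σv f * Σv f)
  products = begin-equality
    Σv (λ i → Σv (λ j → 2 * (f i * f j)))   ≡⟨ Σv-cong (λ i → Σv-*ˡ 2 (λ j → f i * f j)) ⟩
    Σv (λ i → 2 * Σv (λ j → f i * f j))     ≡⟨ Σv-*ˡ 2 (λ i → Σv (λ j → f i * f j)) ⟩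
    2 * Σv (λ i → Σv (λ j → f i * f j))     ≡⟨ cong (2 *_) (Σv-cong (λ i → Σv-*ˡ (f i) f)) ⟩
    2 * Σv (λ i → f i * Σv f)               ≡⟨ cong (2 *_) (Σv-*ʳ (Σv f) f) ⟩
    2 * (Σv f * Σv f)                       ∎

  squares : Σv (λ i → Σv (λ j → f i * f i + f j * f j)) ≡ 2 * (n * Q)
  squares = begin-equality
    Σv (λ i → Σv (λ j → f i * f i + f j * f j))  ≡⟨ Σv-cong (λ i → Σv-+ (λ _ → f i * f i) (λ j → f j * f j)) ⟩
    Σv (λ i → Σv {n} (λ _ → f i * f i) + Q)      ≡⟨ Σv-cong (λ i → cong (_+ Q) (Σv-const {n} (f i * f i))) ⟩
    Σv (λ i → n * (f i * f i) + Q)               ≡⟨ Σv-+ (λ i → n * (f i * f i)) (λ _ → Q) ⟩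
    Σv (λ i → n * (f i * f i)) + Σv {n} (λ _ → Q) ≡⟨ cong₂ _+_ (Σv-*ˡ n (λ i → f i * f i)) (Σv-const {n} Q) ⟩
    n * Q + n * Q                                ≡⟨ cong (n * Q +_) (sym (+-identityʳ (n * Q))) ⟩
    2 * (n * Q)                                  ∎

below-average : ∀ {k} (f : Fin (suc k) → ℕ) → Σ (Fin (suc k)) λ v → suc k * f v ≤ Σv f
below-average {k} f = v , (begin
  suc k * f v          ≡⟨ sym (Σv-const {suc k} (f v)) ⟩
  Σv {suc k} (λ _ → f v) ≤⟨ Σv-mono {suc k} minimal ⟩
  Σv f                 ∎)
  where
  open ≤-Reasoning
  v : Fin (suc k)
  v = argmin f Fin.zero (allFin (suc k))
  minimal : ∀ w → f v ≤ f w
  minimal w = All.lookup (f[argmin]≤f[xs] {f = f} Fin.zero (allFin (suc k))) (∈-allFin w)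

ordered-related-pairs : ∀ {n} (R : Fin n → Fin n → Bool) →
  (∀ i j → R i j ≡ R j i) → (∀ i → R i i ≡ false) →
  Σv (λ i → Σv (λ j → [ R i j ])) ≡ 2 * pairCount R
ordered-related-pairs R R-sym R-irrefl =
  trans (ordered-pairs (λ i j → [ R i j ]) (λ i j → cong [_] (R-sym i j))
                       (λ i → cong [_] (R-irrefl i)))
        (cong (2 *_) (Σv-cong (λ i → Σv-cong (λ j → sym ([∧] (toℕ i <ᵇ toℕ j) (R i j))))))

sameSide : ∀ {n} → Graph n → Fin n → Fin n → Fin n → Bool
sameSide G v i j = adj G i j ∧ not (adj G v i xor adj G v j)

sameSide-bipartite : ∀ {n} (G : Graph n) (v : Fin n) →
  BipartiteAfterDeleting G (sameSide G v)
sameSide-bipartite G v = record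
  { D-sym  = symmetric
  ; D⊆E    = deleted-edge
  ; colour = adj G v
  ; proper = separated
  }
  where
  symmetric : ∀ i j → sameSide G v i j ≡ sameSide G v j i
  symmetric i j rewrite adj-sym G i j | xor-comm (adj G v i) (adj G v j) = refl

  deleted-edge : ∀ i j → sameSide G v i j ≡ true → adj G i j ≡ true
  deleted-edge i j deleted with adj G i j
  ... | true  = refl
  ... | false = deleted

  separated : ∀ i j → adj G i j ≡ true → sameSide G v i j ≡ false →
    adj G v i ≡ adj G v j → ⊥
  separated i j edge kept same
    rewrite edge | same | xor-same (adj G v j) with kept
  ... | ()

-- Pointwise count behind (*): for an edge e = ij and a, b the adjacencies of
-- v to i and j, "e deleted" + "v~i, e" + "v~j, e" = "e" + 2·"vij triangle".
cut-count : ∀ a e b →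
  [ e ∧ not (a xor b) ] + ([ a ] * [ e ] + [ b ] * [ e ]) ≡ [ e ] + 2 * ([ a ] * ([ e ] * [ b ]))
cut-count true  true  true  = refl
cut-count true  true  false = refl
cut-count true  false true  = refl
cut-count true  false false = refl
cut-count false true  true  = refl
cut-count false true  false = refl
cut-count false false true  = refl
cut-count false false false = refl

bound-from-identity : ∀ a n S Q m t → n * a ≤ S → (2 * m) * (2 * m) ≤ n * Q →
  S + Q ≡ n * m + 6 * t → a * n ^ 2 + 4 * m ^ 2 ≤ m * n ^ 2 + 6 * t * n
bound-from-identity a n S Q m t na≤S 4m²≤nQ identity = begin
  a * n ^ 2 + 4 * m ^ 2             ≡⟨ lhs a n m ⟩
  n * (n * a) + (2 * m) * (2 * m)   ≤⟨ +-mono-≤ (*-monoʳ-≤ n na≤S) 4m²≤nQ ⟩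
  n * S + n * Q                     ≡⟨ sym (*-distribˡ-+ n S Q) ⟩
  n * (S + Q)                       ≡⟨ cong (n *_) identity ⟩
  n * (n * m + 6 * t)               ≡⟨ rhs n m t ⟩
  m * n ^ 2 + 6 * t * n             ∎
  where
  open ≤-Reasoning
  -- x ^ 2 unfolds to x * (x * 1)
  lhs : ∀ a n m → a * (n * (n * 1)) + 4 * (m * (m * 1)) ≡ n * (n * a) + (2 * m) * (2 * m)
  lhs = solve-∀
  rhs : ∀ n m t → n * (n * m + 6 * t) ≡ m * (n * (n * 1)) + 6 * t * n
  rhs = solve-∀

module Counting {n : ℕ} (G : Graph n) where

  A : Fin n → Fin n → Bool
  A = adj G

  degree : Fin n → ℕ
  degree i = Σv (λ j → [ A i j ])

  deleted : Fin n → ℕ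
  deleted v = pairCount (sameSide G v)

  sumSquares : ℕ
  sumSquares = Σv (λ i → degree i * degree i)

  handshake : Σv degree ≡ 2 * edges G
  handshake = ordered-related-pairs A (adj-sym G) (irrefl G)

  triangle : Fin n → Fin n → Fin n → ℕ
  triangle i j k = [ A i j ] * ([ A j k ] * [ A i k ])

  ordered-triangles : Σ³ triangle ≡ 6 * triangles G
  ordered-triangles = trans
    (ordered-triples triangle swap₁₂ swap₂₃ (λ i k → cong (λ b → [ b ] * ([ A i k ] * [ A i k ])) (irrefl G i)))
    (cong (6 *_) (Σ³-cong (λ i j k → sym (unfold i j k))))
    where
    swap₁₂ : ∀ i j k → triangle i j k ≡ triangle j i k
    swap₁₂ i j k = cong₂ _*_ (cong [_] (adj-sym G i j)) (*-comm [ A j k ] [ A i k ])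

    reverse : ∀ x y z → x * (y * z) ≡ z * (y * x)
    reverse = solve-∀

    swap₂₃ : ∀ i j k → triangle i j k ≡ triangle i k j
    swap₂₃ i j k rewrite adj-sym G k j = reverse [ A i j ] [ A j k ] [ A i k ]

    unfold : ∀ i j k →
      [ (toℕ i <ᵇ toℕ j) ∧ (toℕ j <ᵇ toℕ k) ∧ A i j ∧ A j k ∧ A i k ] ≡ inc-part triangle i j k
    unfold i j k = begin
      [ i<j ∧ j<k ∧ A i j ∧ A j k ∧ A i k ]              ≡⟨ [∧] i<j _ ⟩
      [ i<j ] * [ j<k ∧ A i j ∧ A j k ∧ A i k ]          ≡⟨ cong ([ i<j ] *_) ([∧] j<k _) ⟩
      [ i<j ] * ([ j<k ] * [ A i j ∧ A j k ∧ A i k ])    ≡⟨ sym (*-assoc [ i<j ] [ j<k ] _) ⟩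
      [ i<j ] * [ j<k ] * [ A i j ∧ A j k ∧ A i k ]      ≡⟨ cong ([ i<j ] * [ j<k ] *_) indicator ⟩
      inc-part triangle i j k                             ∎
      where
      open ≡-Reasoning
      i<j j<k : Bool
      i<j = toℕ i <ᵇ toℕ j
      j<k = toℕ j <ᵇ toℕ k
      indicator : [ A i j ∧ A j k ∧ A i k ] ≡ triangle i j k
      indicator = trans ([∧] (A i j) _) (cong ([ A i j ] *_) ([∧] (A j k) (A i k)))

  -- paths v – i – j counted by their middle vertex i
  paths-by-middle : Σ³ (λ v i j → [ A v i ] * [ A i j ]) ≡ sumSquares
  paths-by-middle = begin
    Σ³ (λ v i j → [ A v i ] * [ A i j ])          ≡⟨ Σv-cong (λ v → Σv-cong (λ i → Σv-*ˡ [ A v i ] (λ j → [ A i j ]))) ⟩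
    Σv (λ v → Σv (λ i → [ A v i ] * degree i))    ≡⟨ Σv-swap (λ v i → [ A v i ] * degree i) ⟩
    Σv (λ i → Σv (λ v → [ A v i ] * degree i))    ≡⟨ Σv-cong (λ i → Σv-*ʳ (degree i) (λ v → [ A v i ])) ⟩
    Σv (λ i → Σv (λ v → [ A v i ]) * degree i)    ≡⟨ Σv-cong (λ i → cong (_* degree i) (Σv-cong (λ v → cong [_] (adj-sym G v i)))) ⟩
    sumSquares                                    ∎
    where open ≡-Reasoning

  paths-by-end : Σ³ (λ v i j → [ A v j ] * [ A i j ]) ≡ sumSquares
  paths-by-end = trans
    (trans (sym (Σ³-swap₂₃ (λ v i j → [ A v j ] * [ A i j ])))
           (Σ³-cong (λ v i j → cong ([ A v i ] *_) (cong [_] (adj-sym G j i)))))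
    paths-by-middle

  -- summing cut-count over all triples (v, i, j)
  doubled-identity : 2 * (Σv deleted + sumSquares) ≡ 2 * (n * edges G + 6 * triangles G)
  doubled-identity = begin
    2 * (Σv deleted + sumSquares)                               ≡⟨ *-distribˡ-+ 2 (Σv deleted) sumSquares ⟩
    2 * Σv deleted + 2 * sumSquares                             ≡⟨ cong₂ _+_ deletions (cong₂ _+_ (sym paths-by-middle) (cong (_+ 0) (sym paths-by-end))) ⟩
    Σ³ D + (Σ³ P₁ + (Σ³ P₂ + 0))                                ≡⟨ cong (Σ³ D +_) (trans (cong (Σ³ P₁ +_) (+-identityʳ (Σ³ P₂))) (sym (Σ³-+ P₁ P₂))) ⟩
    Σ³ D + Σ³ (λ v i j → P₁ v i j + P₂ v i j)                   ≡⟨ sym (Σ³-+ D _) ⟩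
    Σ³ (λ v i j → D v i j + (P₁ v i j + P₂ v i j))              ≡⟨ Σ³-cong (λ v i j → cut-count (A v i) (A i j) (A v j)) ⟩
    Σ³ (λ v i j → [ A i j ] + 2 * triangle v i j)               ≡⟨ Σ³-+ (λ v i j → [ A i j ]) _ ⟩
    Σ³ (λ v i j → [ A i j ]) + Σ³ (λ v i j → 2 * triangle v i j) ≡⟨ cong₂ _+_ edge-term triangle-term ⟩
    n * (2 * edges G) + 2 * (6 * triangles G)                   ≡⟨ regroup n (edges G) (triangles G) ⟩
    2 * (n * edges G + 6 * triangles G)                         ∎
    where
    open ≡-Reasoning
    D P₁ P₂ : Fin n → Fin n → Fin n → ℕ
    D  v i j = [ sameSide G v i j ]
    P₁ v i j = [ A v i ] * [ A i j ]
    P₂ v i j = [ A v j ] * [ A i j ]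

    deletions : 2 * Σv deleted ≡ Σ³ D
    deletions = trans (sym (Σv-*ˡ 2 deleted)) (Σv-cong (λ v → sym
      (ordered-related-pairs (sameSide G v) (BipartiteAfterDeleting.D-sym (sameSide-bipartite G v))
                             (λ i → cong (_∧ not (A v i xor A v i)) (irrefl G i)))))

    edge-term : Σ³ (λ v i j → [ A i j ]) ≡ n * (2 * edges G)
    edge-term = trans (Σv-const {n} (Σv degree)) (cong (n *_) handshake)

    triangle-term : Σ³ (λ v i j → 2 * triangle v i j) ≡ 2 * (6 * triangles G)
    triangle-term = trans (Σ³-*ˡ 2 triangle) (cong (2 *_) ordered-triangles)

    regroup : ∀ n m t → n * (2 * m) + 2 * (6 * t) ≡ 2 * (n * m + 6 * t)
    regroup = solve-∀

  cut-identity : Σv deleted + sumSquares ≡ n * edges G + 6 * triangles G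
  cut-identity = *-cancelˡ-≡ _ _ 2 doubled-identity

lemma2p1 : (n : ℕ) → 1 ≤ n → (G : Graph n) →
    Σ (Fin n → Fin n → Bool) λ D →
      BipartiteAfterDeleting G D ×
      (pairCount D * n ^ 2 + 4 * edges G ^ 2 ≤ edges G * n ^ 2 + 6 * triangles G * n)
lemma2p1 (suc k) _ G =
  let v , v-below-average = below-average deleted in
  sameSide G v , sameSide-bipartite G v ,
  bound-from-identity (deleted v) (suc k) (Σv deleted) sumSquares (edges G) (triangles G)
    v-below-average
    (subst (λ s → s * s ≤ suc k * sumSquares) handshake (cauchy-schwarz degree))
    cut-identity
  where open Counting G
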